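{- Let $n\geq 1$, $r\geq 0$ and $m\geq 1$ be integers. Suppose $v_1,w_1,\dots,v_m,w_m$ are $2m$ distinct points of $Q_n$ such that $d_H(v_i,w_i)>r$ for each $i$, while every other pair of distinct points among them has Hamming distance at most $r$. Let $\alpha$ be the $(m-1)$-cycle in $VR(Q_n;r)$ given by the boundary of the cross-polytope on these vertices, i.e. the fundamental cycle of the subcomplex consisting of all simplices spanned by subsets of $\{v_1,w_1,\dots,v_m,w_m\}$ containing no pair $\{v_i,w_i\}$ (a simplicial $(m-1)$-sphere). Suppose the homology class $a\in H_{m-1}(VR(Q_n;r);\mathbb{Z})$ represented by $\alpha$ is non-trivial. Then $\{v_1,w_1,\dots,v_m,w_m\}$ is a total dominating set of the graph $G_{n,r}^c$.
   Context: $Q_n$ is the set of binary strings of length $n$ with the Hamming distance $d_H$ (number of differing coordinates). $VR(Q_n;r)$ is the Vietoris-Rips complex: vertex set $Q_n$, simplices the nonempty subsets of diameter at most $r$. $G_{n,r}$ is the graph on vertex set $Q_n$ with an edge between distinct $a,b$ iff $d_H(a,b)\leq r$; $G_{n,r}^c$ is its complement, so distinct $a,b$ are adjacent in $G_{n,r}^c$ iff $d_H(a,b)>r$. A total dominating set of a graph $G$ with no isolated vertices is a subset $S$ of vertices such that every vertex of $G$ (including those in $S$) is adjacent to some vertex of $S$. -}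

module Defs where

open import Data.Bool using (Bool; true; false)
open import Data.Nat as ℕ using (ℕ; zero; suc; _≤_; _<_)
open import Data.Integer as ℤ using (ℤ; 0ℤ; 1ℤ; -_; _*_; _+_)
open import Data.Fin using (Fin)
open import Data.Vec using (Vec; []; _∷_)
open import Data.List as List using (List; []; _∷_; _++_; map; concatMap; length)
open import Data.List.Membership.Propositional using (_∈_)
open import Data.List.Relation.Unary.All using (All)
open import Data.Maybe using (Maybe; just; nothing)
open import Data.Product using (Σ; ∃; _×_; _,_)
open import Data.Sum using (_⊎_)
open import Relation.Nullary using (¬_; yes; no)
open import Relation.Binary.PropositionalEquality using (_≡_; _≢_)
import Data.Vec.Properties as VecP
import Data.Bool.Properties as BoolP
import Data.List.Properties as ListP

Q : ℕ → Set
Q n = Vec Bool n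

dH : ∀ {n} → Q n → Q n → ℕ
dH [] [] = 0
dH (true ∷ a) (true ∷ b) = dH a b
dH (false ∷ a) (false ∷ b) = dH a b
dH (true ∷ a) (false ∷ b) = suc (dH a b)
dH (false ∷ a) (true ∷ b) = suc (dH a b)

-- A fixed total (lexicographic) order on Q n, used to orient simplices

data Cmp : Set where
  lt eq gt : Cmp

cmpQ : ∀ {n} → Q n → Q n → Cmp
cmpQ [] [] = eq
cmpQ (false ∷ a) (true ∷ b) = lt
cmpQ (true ∷ a) (false ∷ b) = gt
cmpQ (false ∷ a) (false ∷ b) = cmpQ a b
cmpQ (true ∷ a) (true ∷ b) = cmpQ a b

-- insert a vertex into a strictly increasing list; returns the sign of the
-- permutation performed, or nothing if the vertex is already present
insertS : ∀ {n} → Q n → List (Q n) → Maybe (ℤ × List (Q n))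
insertS x [] = just (1ℤ , x ∷ [])
insertS x (y ∷ ys) with cmpQ x y
... | lt = just (1ℤ , x ∷ y ∷ ys)
... | eq = nothing
... | gt with insertS x ys
...   | nothing = nothing
...   | just (s , zs) = just (- s , y ∷ zs)

-- sort an ordered tuple of vertices: nothing if it has a repeated vertex
-- (degenerate, hence zero), otherwise (sign of sorting permutation, sorted list)
sortS : ∀ {n} → List (Q n) → Maybe (ℤ × List (Q n))
sortS [] = just (1ℤ , [])
sortS (x ∷ xs) with sortS xs
... | nothing = nothing
... | just (s , ys) with insertS x ys
...   | nothing = nothing
...   | just (t , zs) = just (s * t , zs)

-- Oriented simplicial chains with ℤ coefficients:
-- a chain is a finite formal ℤ-combination of ordered tuples of vertices,
-- with [x_{π0},...,x_{πk}] = sign(π)[x_0,...,x_k] and degenerate tuples = 0.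

Chain : ℕ → Set
Chain n = List (ℤ × List (Q n))

-- coefficient of a chain at the (sorted) simplex σ
coeff : ∀ {n} → Chain n → List (Q n) → ℤ
coeff [] σ = 0ℤ
coeff ((a , τ) ∷ c) σ with sortS τ
... | nothing = coeff c σ
... | just (s , τ') with ListP.≡-dec (VecP.≡-dec BoolP._≟_) τ' σ
...   | yes _ = a * s + coeff c σ
...   | no _ = coeff c σ

faces : ∀ {A : Set} → List A → List (ℤ × List A)
faces [] = []
faces (x ∷ xs) = (1ℤ , xs) ∷ map (λ { (s , f) → (- s , x ∷ f) }) (faces xs)

∂ : ∀ {n} → Chain n → Chain n
∂ = concatMap (λ { (a , τ) → map (λ { (s , f) → (a * s , f) }) (faces τ) })

InVR : ∀ {n} → ℕ → List (Q n) → Set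
InVR {n} r τ = ∀ (x y : Q n) → x ∈ τ → y ∈ τ → dH x y ≤ r

IsVRChain : ∀ {n} → ℕ → ℕ → Chain n → Set
IsVRChain r k c = All (λ { (a , τ) → length τ ≡ suc k × InVR r τ }) c

IsBoundaryVR : ∀ {n} → ℕ → ℕ → Chain n → Set
IsBoundaryVR {n} r k α =
  Σ (Chain n) λ c → IsVRChain r (suc k) c × (∀ (σ : List (Q n)) → coeff (∂ c) σ ≡ coeff α σ)

-- Fundamental cycle of the boundary of the cross-polytope on pairs
-- (v_1,w_1),...,(v_m,w_m): the join (v_1 - w_1) * ... * (v_m - w_m),
-- i.e. Σ_ε (-1)^{|ε|} [u_1^{ε_1}, ..., u_m^{ε_m}].

crossCycle : ∀ {n} → List (Q n × Q n) → Chain n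
crossCycle [] = (1ℤ , []) ∷ []
crossCycle ((v , w) ∷ ps) =
  map (λ { (a , τ) → (a , v ∷ τ) }) (crossCycle ps)
  ++ map (λ { (a , τ) → (- a , w ∷ τ) }) (crossCycle ps)

crossCycleOf : ∀ {n m} → (Fin m → Q n) → (Fin m → Q n) → Chain n
crossCycleOf v w = crossCycle (List.tabulate (λ i → (v i , w i)))

AdjComp : ∀ {n} → ℕ → Q n → Q n → Set
AdjComp r a b = a ≢ b × r < dH a b

TotalDominatingSet : {V : Set} → (V → V → Set) → (V → Set) → Set
TotalDominatingSet {V} Adj S = ∀ (x : V) → Σ V λ s → S s × Adj x s

PairSet : ∀ {n m} → (Fin m → Q n) → (Fin m → Q n) → Q n → Set
PairSet {m = m} v w x = Σ (Fin m) λ i → x ≡ v i ⊎ x ≡ w i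

-- If some point x were within distance r of every v_i and w_i, then every simplex of the cone
-- x * α would lie in VR(Q_n; r), and since α is a cycle the cone formula ∂(x * α) = α - x * ∂α
-- would exhibit α as a boundary.

module Submission where

open import Defs
open import Data.Bool using (true; false)
import Data.Bool.Properties as BoolP
open import Data.Nat using (ℕ; suc; _≤_; _<_; z≤n)
import Data.Nat.Properties as ℕP
open import Data.Integer using (ℤ; 0ℤ; 1ℤ; -_; _*_; _+_; _-_)
import Data.Integer.Properties as ℤP
open import Algebra.Properties.CommutativeSemigroup ℤP.+-commutativeSemigroup using (x∙yz≈y∙xz)
open import Data.Fin using (Fin)
import Data.Fin.Properties as FinP
open import Data.Vec using ([]; _∷_)
import Data.Vec.Properties as VecP
open import Data.List using (List; []; _∷_; _++_; map; length; tabulate)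
import Data.List.Properties as ListP
open import Data.List.Relation.Unary.All as All using (All; []; _∷_)
import Data.List.Relation.Unary.All.Properties as AllP
open import Data.List.Relation.Unary.Any using (Any; here; there)
import Data.List.Relation.Unary.Any.Properties as AnyP
open import Data.List.Relation.Unary.AllPairs using (AllPairs; []; _∷_)
import Data.List.Relation.Unary.AllPairs.Properties as AllPairsP
open import Data.Maybe using (Maybe; just; nothing)
open import Data.Product using (_×_; _,_; proj₁; proj₂; ∃₂)
open import Data.Sum using (_⊎_; inj₁; inj₂)
open import Function using (_∘_)
open import Relation.Nullary using (¬_; Dec; yes; no; contradiction)
open import Relation.Nullary.Decidable using (_×-dec_; _⊎-dec_; ¬?)
open import Relation.Binary.PropositionalEquality

cmpQ-refl : ∀ {n} (x : Q n) → cmpQ x x ≡ eq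
cmpQ-refl [] = refl
cmpQ-refl (true ∷ x) = cmpQ-refl x
cmpQ-refl (false ∷ x) = cmpQ-refl x

dH-refl : ∀ {n} (x : Q n) → dH x x ≡ 0
dH-refl [] = refl
dH-refl (true ∷ x) = dH-refl x
dH-refl (false ∷ x) = dH-refl x

dH-sym : ∀ {n} (x y : Q n) → dH x y ≡ dH y x
dH-sym [] [] = refl
dH-sym (true ∷ x) (true ∷ y) = dH-sym x y
dH-sym (true ∷ x) (false ∷ y) = cong suc (dH-sym x y)
dH-sym (false ∷ x) (true ∷ y) = cong suc (dH-sym x y)
dH-sym (false ∷ x) (false ∷ y) = dH-sym x y

module Chains {n : ℕ} where

  infix 4 _≈_
  _≈_ : Chain n → Chain n → Set
  c ≈ d = ∀ σ → coeff c σ ≡ coeff d σ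

  IsCycle : Chain n → Set
  IsCycle c = ∂ c ≈ []

  neg : Chain n → Chain n
  neg = map (λ (a , τ) → (- a , τ))

  cone : Q n → Chain n → Chain n
  cone x = map (λ (a , τ) → (a , x ∷ τ))

  -- the decision procedure used by coeff, so that `with` on it unfolds coeff
  _≟ₛ_ : (σ τ : List (Q n)) → Dec (σ ≡ τ)
  _≟ₛ_ = ListP.≡-dec (VecP.≡-dec BoolP._≟_)

  termCoeff : ℤ → Maybe (ℤ × List (Q n)) → List (Q n) → ℤ
  termCoeff a nothing σ = 0ℤ
  termCoeff a (just (s , τ)) σ with τ ≟ₛ σ
  ... | yes _ = a * s
  ... | no _ = 0ℤ

  termCoeff-≡ : ∀ a s σ → termCoeff a (just (s , σ)) σ ≡ a * s
  termCoeff-≡ a s σ with σ ≟ₛ σ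
  ... | yes _ = refl
  ... | no σ≢σ = contradiction refl σ≢σ

  termCoeff-≢ : ∀ a s {τ σ} → τ ≢ σ → termCoeff a (just (s , τ)) σ ≡ 0ℤ
  termCoeff-≢ a s {τ} {σ} τ≢σ with τ ≟ₛ σ
  ... | yes τ≡σ = contradiction τ≡σ τ≢σ
  ... | no _ = refl

  termCoeff-neg : ∀ a m σ → termCoeff (- a) m σ ≡ - termCoeff a m σ
  termCoeff-neg a nothing σ = refl
  termCoeff-neg a (just (s , τ)) σ with τ ≟ₛ σ
  ... | yes _ = sym (ℤP.neg-distribˡ-* a s)
  ... | no _ = refl

  coeff-∷ : ∀ a τ c σ → coeff ((a , τ) ∷ c) σ ≡ termCoeff a (sortS τ) σ + coeff c σ
  coeff-∷ a τ c σ with sortS τ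
  ... | nothing = sym (ℤP.+-identityˡ _)
  ... | just (s , τ′) with τ′ ≟ₛ σ
  ...   | yes _ = refl
  ...   | no _ = sym (ℤP.+-identityˡ _)

  coeff-++ : ∀ c d σ → coeff (c ++ d) σ ≡ coeff c σ + coeff d σ
  coeff-++ [] d σ = sym (ℤP.+-identityˡ _)
  coeff-++ ((a , τ) ∷ c) d σ = begin
    coeff ((a , τ) ∷ c ++ d) σ                ≡⟨ coeff-∷ a τ (c ++ d) σ ⟩
    t + coeff (c ++ d) σ                      ≡⟨ cong (t +_) (coeff-++ c d σ) ⟩
    t + (coeff c σ + coeff d σ)               ≡⟨ ℤP.+-assoc t _ _ ⟨
    t + coeff c σ + coeff d σ                 ≡⟨ cong (_+ coeff d σ) (coeff-∷ a τ c σ) ⟨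
    coeff ((a , τ) ∷ c) σ + coeff d σ         ∎
    where
    open ≡-Reasoning
    t = termCoeff a (sortS τ) σ

  coeff-neg : ∀ c σ → coeff (neg c) σ ≡ - coeff c σ
  coeff-neg [] σ = refl
  coeff-neg ((a , τ) ∷ c) σ = begin
    coeff ((- a , τ) ∷ neg c) σ                    ≡⟨ coeff-∷ (- a) τ (neg c) σ ⟩
    termCoeff (- a) (sortS τ) σ + coeff (neg c) σ  ≡⟨ cong₂ _+_ (termCoeff-neg a (sortS τ) σ) (coeff-neg c σ) ⟩
    - termCoeff a (sortS τ) σ + - coeff c σ        ≡⟨ ℤP.neg-distrib-+ (termCoeff a (sortS τ) σ) _ ⟨
    - (termCoeff a (sortS τ) σ + coeff c σ)        ≡⟨ cong -_ (coeff-∷ a τ c σ) ⟨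
    - coeff ((a , τ) ∷ c) σ                        ∎
    where open ≡-Reasoning

  insertSigned : Q n → Maybe (ℤ × List (Q n)) → Maybe (ℤ × List (Q n))
  insertSigned x nothing = nothing
  insertSigned x (just (s , ys)) with insertS x ys
  ... | nothing = nothing
  ... | just (t , zs) = just (s * t , zs)

  sortS-∷ : ∀ x τ → sortS (x ∷ τ) ≡ insertSigned x (sortS τ)
  sortS-∷ x τ with sortS τ
  ... | nothing = refl
  ... | just (s , ys) with insertS x ys
  ...   | nothing = refl
  ...   | just _ = refl

  data Insertion (x : Q n) : List (Q n) → ℤ → List (Q n) → Set where
    into-[] : Insertion x [] 1ℤ (x ∷ [])
    before : ∀ {y ys} → cmpQ x y ≡ lt → Insertion x (y ∷ ys) 1ℤ (x ∷ y ∷ ys)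
    after : ∀ {y ys s zs} → cmpQ x y ≡ gt → Insertion x ys s zs → Insertion x (y ∷ ys) (- s) (y ∷ zs)

  insertS⇒Insertion : ∀ x ys {s zs} → insertS x ys ≡ just (s , zs) → Insertion x ys s zs
  insertS⇒Insertion x [] refl = into-[]
  insertS⇒Insertion x (y ∷ ys) p with cmpQ x y in x<y
  insertS⇒Insertion x (y ∷ ys) refl | lt = before x<y
  insertS⇒Insertion x (y ∷ ys) () | eq
  insertS⇒Insertion x (y ∷ ys) p | gt with insertS x ys in x↦zs
  insertS⇒Insertion x (y ∷ ys) () | gt | nothing
  insertS⇒Insertion x (y ∷ ys) refl | gt | just _ = after x<y (insertS⇒Insertion x ys x↦zs)

  Insertion-unique : ∀ {x ys₁ ys₂ s₁ s₂ zs} →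
    Insertion x ys₁ s₁ zs → Insertion x ys₂ s₂ zs → ys₁ ≡ ys₂ × s₁ ≡ s₂
  Insertion-unique into-[] into-[] = refl , refl
  Insertion-unique (before _) (before _) = refl , refl
  Insertion-unique {x} (before _) (after x>x _) with trans (sym (cmpQ-refl x)) x>x
  ... | ()
  Insertion-unique {x} (after x>x _) (before _) with trans (sym (cmpQ-refl x)) x>x
  ... | ()
  Insertion-unique (after _ p) (after _ q) with Insertion-unique p q
  ... | refl , refl = refl , refl

  insertS-injective : ∀ {x ys₁ ys₂ s₁ s₂ zs} →
    insertS x ys₁ ≡ just (s₁ , zs) → insertS x ys₂ ≡ just (s₂ , zs) → ys₁ ≡ ys₂ × s₁ ≡ s₂
  insertS-injective {x} {ys₁} {ys₂} p q =
    Insertion-unique (insertS⇒Insertion x ys₁ p) (insertS⇒Insertion x ys₂ q)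

  termCoeff-insertSigned : ∀ {x ys₀ t₀ σ} → insertS x ys₀ ≡ just (t₀ , σ) →
    ∀ a m → termCoeff a (insertSigned x m) σ ≡ t₀ * termCoeff a m ys₀
  termCoeff-insertSigned {t₀ = t₀} _ a nothing = sym (ℤP.*-zeroʳ t₀)
  termCoeff-insertSigned {x} {ys₀} {t₀} {σ} x↦σ a (just (s , ys)) with ys ≟ₛ ys₀
  ... | yes refl rewrite x↦σ = begin
    termCoeff a (just (s * t₀ , σ)) σ   ≡⟨ termCoeff-≡ a (s * t₀) σ ⟩
    a * (s * t₀)                        ≡⟨ ℤP.*-assoc a s t₀ ⟨
    a * s * t₀                          ≡⟨ ℤP.*-comm (a * s) t₀ ⟩
    t₀ * (a * s)                        ∎
    where open ≡-Reasoning
  ... | no ys≢ys₀ = trans lhs≡0 (sym (ℤP.*-zeroʳ t₀))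
    where
    lhs≡0 : termCoeff a (insertSigned x (just (s , ys))) σ ≡ 0ℤ
    lhs≡0 with insertS x ys in x↦zs
    ... | nothing = refl
    ... | just (t , zs) = termCoeff-≢ a (s * t) {zs} {σ} λ { refl → ys≢ys₀ (proj₁ (insertS-injective x↦zs x↦σ)) }

  -- The coefficient of x * d at σ is ± the coefficient of d at σ with x removed, or 0 when σ
  -- does not arise by inserting x; so coning preserves null chains.
  Removable : Q n → List (Q n) → Set
  Removable x σ = ∃₂ λ t ys → insertS x ys ≡ just (t , σ)

  termCoeff-insertSigned-≡0⊎Removable : ∀ x σ a m →
    termCoeff a (insertSigned x m) σ ≡ 0ℤ ⊎ Removable x σ
  termCoeff-insertSigned-≡0⊎Removable x σ a nothing = inj₁ refl
  termCoeff-insertSigned-≡0⊎Removable x σ a (just (s , ys)) with insertS x ys in x↦zs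
  ... | nothing = inj₁ refl
  ... | just (t , zs) with zs ≟ₛ σ
  ...   | yes refl = inj₂ (t , ys , x↦zs)
  ...   | no _ = inj₁ refl

  coeff-cone-≡0⊎Removable : ∀ x σ d → coeff (cone x d) σ ≡ 0ℤ ⊎ Removable x σ
  coeff-cone-≡0⊎Removable x σ [] = inj₁ refl
  coeff-cone-≡0⊎Removable x σ ((a , τ) ∷ d)
    with termCoeff-insertSigned-≡0⊎Removable x σ a (sortS τ) | coeff-cone-≡0⊎Removable x σ d
  ... | inj₂ removable | _ = inj₂ removable
  ... | inj₁ _ | inj₂ removable = inj₂ removable
  ... | inj₁ head≡0 | inj₁ tail≡0 = inj₁ (begin
    coeff ((a , x ∷ τ) ∷ cone x d) σ                           ≡⟨ coeff-∷ a (x ∷ τ) (cone x d) σ ⟩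
    termCoeff a (sortS (x ∷ τ)) σ + coeff (cone x d) σ         ≡⟨ cong (λ m → termCoeff a m σ + _) (sortS-∷ x τ) ⟩
    termCoeff a (insertSigned x (sortS τ)) σ + coeff (cone x d) σ ≡⟨ cong₂ _+_ head≡0 tail≡0 ⟩
    0ℤ                                                          ∎)
    where open ≡-Reasoning

  coeff-cone-removable : ∀ {x ys t σ} → insertS x ys ≡ just (t , σ) →
    ∀ d → coeff (cone x d) σ ≡ t * coeff d ys
  coeff-cone-removable {t = t} _ [] = sym (ℤP.*-zeroʳ t)
  coeff-cone-removable {x} {ys} {t} {σ} x↦σ ((a , τ) ∷ d) = begin
    coeff ((a , x ∷ τ) ∷ cone x d) σ                      ≡⟨ coeff-∷ a (x ∷ τ) (cone x d) σ ⟩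
    termCoeff a (sortS (x ∷ τ)) σ + coeff (cone x d) σ    ≡⟨ cong (λ m → termCoeff a m σ + _) (sortS-∷ x τ) ⟩
    termCoeff a (insertSigned x (sortS τ)) σ + coeff (cone x d) σ
      ≡⟨ cong₂ _+_ (termCoeff-insertSigned x↦σ a (sortS τ)) (coeff-cone-removable x↦σ d) ⟩
    t * termCoeff a (sortS τ) ys + t * coeff d ys         ≡⟨ ℤP.*-distribˡ-+ t _ _ ⟨
    t * (termCoeff a (sortS τ) ys + coeff d ys)           ≡⟨ cong (t *_) (coeff-∷ a τ d ys) ⟨
    t * coeff ((a , τ) ∷ d) ys                            ∎
    where open ≡-Reasoning

  cone-≈[] : ∀ x d → d ≈ [] → cone x d ≈ []
  cone-≈[] x d d≈[] σ with coeff-cone-≡0⊎Removable x σ d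
  ... | inj₁ ≡0 = ≡0
  ... | inj₂ (t , ys , x↦σ) = begin
    coeff (cone x d) σ  ≡⟨ coeff-cone-removable x↦σ d ⟩
    t * coeff d ys      ≡⟨ cong (t *_) (d≈[] ys) ⟩
    t * 0ℤ              ≡⟨ ℤP.*-zeroʳ t ⟩
    0ℤ                  ∎
    where open ≡-Reasoning

  ∂-++ : ∀ (c d : Chain n) → ∂ (c ++ d) ≡ ∂ c ++ ∂ d
  ∂-++ [] d = refl
  ∂-++ (e ∷ c) d = trans (cong (_ ++_) (∂-++ c d)) (sym (ListP.++-assoc _ (∂ c) (∂ d)))

  ∂-neg : ∀ (c : Chain n) → ∂ (neg c) ≡ neg (∂ c)
  ∂-neg [] = refl
  ∂-neg ((a , τ) ∷ c) = begin
    map (λ (s , f) → (- a * s , f)) (faces τ) ++ ∂ (neg c)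
      ≡⟨ cong₂ _++_ (ListP.map-cong (λ (s , f) → cong (_, f) (sym (ℤP.neg-distribˡ-* a s))) (faces τ)) (∂-neg c) ⟩
    map (λ (s , f) → (- (a * s) , f)) (faces τ) ++ neg (∂ c)
      ≡⟨ cong (_++ neg (∂ c)) (ListP.map-∘ (faces τ)) ⟩
    neg (map (λ (s , f) → (a * s , f)) (faces τ)) ++ neg (∂ c)
      ≡⟨ ListP.map-++ _ (map _ (faces τ)) (∂ c) ⟨
    neg (∂ ((a , τ) ∷ c))
      ∎
    where open ≡-Reasoning

  ∂-cone-term : ∀ a x τ → ∂ ((a , x ∷ τ) ∷ []) ≡ (a * 1ℤ , τ) ∷ cone x (neg (∂ ((a , τ) ∷ [])))
  ∂-cone-term a x τ = cong ((a * 1ℤ , τ) ∷_) (begin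
    map (λ (s , f) → (a * s , f)) (map (λ (s , f) → (- s , x ∷ f)) (faces τ)) ++ []
      ≡⟨ ListP.++-identityʳ _ ⟩
    map (λ (s , f) → (a * s , f)) (map (λ (s , f) → (- s , x ∷ f)) (faces τ))
      ≡⟨ ListP.map-∘ (faces τ) ⟨
    map (λ (s , f) → (a * - s , x ∷ f)) (faces τ)
      ≡⟨ ListP.map-cong (λ (s , f) → cong (_, x ∷ f) (sym (ℤP.neg-distribʳ-* a s))) (faces τ) ⟩
    map (λ (s , f) → (- (a * s) , x ∷ f)) (faces τ)
      ≡⟨ trans (ListP.map-∘ (faces τ)) (cong (cone x) (ListP.map-∘ (faces τ))) ⟩
    cone x (neg (map (λ (s , f) → (a * s , f)) (faces τ)))
      ≡⟨ cong (cone x ∘ neg) (ListP.++-identityʳ _) ⟨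
    cone x (neg (∂ ((a , τ) ∷ [])))
      ∎)
    where open ≡-Reasoning

  ∂-cone : ∀ x c → ∂ (cone x c) ≈ c ++ cone x (neg (∂ c))
  ∂-cone x [] σ = refl
  ∂-cone x ((a , τ) ∷ c) σ = begin
    coeff (∂ ((a , x ∷ τ) ∷ cone x c)) σ
      ≡⟨ cong (λ l → coeff l σ) (trans (∂-++ ((a , x ∷ τ) ∷ []) (cone x c)) (cong (_++ ∂ (cone x c)) (∂-cone-term a x τ))) ⟩
    coeff ((a * 1ℤ , τ) ∷ Kτ ++ ∂ (cone x c)) σ
      ≡⟨ coeff-∷ (a * 1ℤ) τ _ σ ⟩
    termCoeff (a * 1ℤ) (sortS τ) σ + coeff (Kτ ++ ∂ (cone x c)) σ
      ≡⟨ cong₂ _+_ (cong (λ b → termCoeff b (sortS τ) σ) (ℤP.*-identityʳ a)) (coeff-++ Kτ _ σ) ⟩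
    t + (coeff Kτ σ + coeff (∂ (cone x c)) σ)
      ≡⟨ cong (λ z → t + (coeff Kτ σ + z)) (trans (∂-cone x c σ) (coeff-++ c Kc σ)) ⟩
    t + (coeff Kτ σ + (coeff c σ + coeff Kc σ))
      ≡⟨ cong (t +_) (x∙yz≈y∙xz (coeff Kτ σ) (coeff c σ) (coeff Kc σ)) ⟩
    t + (coeff c σ + (coeff Kτ σ + coeff Kc σ))
      ≡⟨ cong (t +_) (trans (coeff-++ c _ σ) (cong (coeff c σ +_) (coeff-++ Kτ Kc σ))) ⟨
    t + coeff (c ++ Kτ ++ Kc) σ
      ≡⟨ coeff-∷ a τ _ σ ⟨
    coeff ((a , τ) ∷ c ++ Kτ ++ Kc) σ
      ≡⟨ cong (λ l → coeff ((a , τ) ∷ c ++ l) σ) Kτ++Kc ⟩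
    coeff ((a , τ) ∷ c ++ cone x (neg (∂ ((a , τ) ∷ c)))) σ
      ∎
    where
    open ≡-Reasoning
    t = termCoeff a (sortS τ) σ
    Kτ = cone x (neg (∂ ((a , τ) ∷ [])))
    Kc = cone x (neg (∂ c))
    Kτ++Kc : Kτ ++ Kc ≡ cone x (neg (∂ ((a , τ) ∷ c)))
    Kτ++Kc = begin
      Kτ ++ Kc                                       ≡⟨ ListP.map-++ _ (neg (∂ ((a , τ) ∷ []))) _ ⟨
      cone x (neg (∂ ((a , τ) ∷ [])) ++ neg (∂ c))   ≡⟨ cong (cone x) (ListP.map-++ _ (∂ ((a , τ) ∷ [])) (∂ c)) ⟨
      cone x (neg (∂ ((a , τ) ∷ []) ++ ∂ c))         ≡⟨ cong (cone x ∘ neg) (∂-++ ((a , τ) ∷ []) c) ⟨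
      cone x (neg (∂ ((a , τ) ∷ c)))                 ∎

  ∂-cone-cycle : ∀ x c → IsCycle c → ∂ (cone x c) ≈ c
  ∂-cone-cycle x c ∂c≈[] σ = begin
    coeff (∂ (cone x c)) σ                              ≡⟨ ∂-cone x c σ ⟩
    coeff (c ++ cone x (neg (∂ c))) σ                   ≡⟨ coeff-++ c _ σ ⟩
    coeff c σ + coeff (cone x (neg (∂ c))) σ            ≡⟨ cong (coeff c σ +_) (cone-≈[] x (neg (∂ c)) neg∂c≈[] σ) ⟩
    coeff c σ + 0ℤ                                      ≡⟨ ℤP.+-identityʳ _ ⟩
    coeff c σ                                           ∎
    where
    open ≡-Reasoning
    neg∂c≈[] : neg (∂ c) ≈ []
    neg∂c≈[] τ = trans (coeff-neg (∂ c) τ) (cong -_ (∂c≈[] τ))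

  neg-cycle : ∀ c → IsCycle c → IsCycle (neg c)
  neg-cycle c ∂c≈[] σ = begin
    coeff (∂ (neg c)) σ  ≡⟨ cong (λ l → coeff l σ) (∂-neg c) ⟩
    coeff (neg (∂ c)) σ  ≡⟨ coeff-neg (∂ c) σ ⟩
    - coeff (∂ c) σ      ≡⟨ cong -_ (∂c≈[] σ) ⟩
    0ℤ                   ∎
    where open ≡-Reasoning

  crossCycle-∷ : ∀ v w ps → crossCycle ((v , w) ∷ ps) ≡ cone v (crossCycle ps) ++ cone w (neg (crossCycle ps))
  crossCycle-∷ v w ps = cong (cone v (crossCycle ps) ++_) (ListP.map-∘ (crossCycle ps))

  crossCycle-isCycle : ∀ ps → IsCycle (crossCycle ps)
  crossCycle-isCycle [] σ = refl
  crossCycle-isCycle ((v , w) ∷ ps) σ = begin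
    coeff (∂ (crossCycle ((v , w) ∷ ps))) σ
      ≡⟨ cong (λ l → coeff (∂ l) σ) (crossCycle-∷ v w ps) ⟩
    coeff (∂ (cone v C ++ cone w (neg C))) σ
      ≡⟨ cong (λ l → coeff l σ) (∂-++ (cone v C) _) ⟩
    coeff (∂ (cone v C) ++ ∂ (cone w (neg C))) σ
      ≡⟨ coeff-++ (∂ (cone v C)) _ σ ⟩
    coeff (∂ (cone v C)) σ + coeff (∂ (cone w (neg C))) σ
      ≡⟨ cong₂ _+_ (∂-cone-cycle v C ∂C≈[] σ) (∂-cone-cycle w (neg C) (neg-cycle C ∂C≈[]) σ) ⟩
    coeff C σ + coeff (neg C) σ
      ≡⟨ cong (coeff C σ +_) (coeff-neg C σ) ⟩
    coeff C σ - coeff C σ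
      ≡⟨ ℤP.+-inverseʳ (coeff C σ) ⟩
    0ℤ
      ∎
    where
    open ≡-Reasoning
    C = crossCycle ps
    ∂C≈[] = crossCycle-isCycle ps

open Chains

module VietorisRips {n : ℕ} (r : ℕ) where

  InVR-∷ : ∀ {u : Q n} {τ} → All (λ y → dH u y ≤ r) τ → InVR r τ → InVR r (u ∷ τ)
  InVR-∷ {u} near inVR .u .u (here refl) (here refl) = subst (_≤ r) (sym (dH-refl u)) z≤n
  InVR-∷ near inVR _ y (here refl) (there y∈τ) = All.lookup near y∈τ
  InVR-∷ {u} near inVR x _ (there x∈τ) (here refl) = subst (_≤ r) (dH-sym u x) (All.lookup near x∈τ)
  InVR-∷ near inVR x y (there x∈τ) (there y∈τ) = inVR x y x∈τ y∈τ

  infix 4 _∈₂_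
  _∈₂_ : Q n → Q n × Q n → Set
  y ∈₂ (v , w) = y ≡ v ⊎ y ≡ w

  VertexOf : List (Q n × Q n) → Q n → Set
  VertexOf ps y = Any (y ∈₂_) ps

  Near : Q n × Q n → Q n × Q n → Set
  Near p q = ∀ {x y} → x ∈₂ p → y ∈₂ q → dH x y ≤ r

  near-vertex : ∀ {p ps x y} → All (Near p) ps → x ∈₂ p → VertexOf ps y → dH x y ≤ r
  near-vertex nearAll x∈p = All.lookupWith (λ near y∈q → near x∈p y∈q) nearAll

  VRTuple : ℕ → (Q n → Set) → List (Q n) → Set
  VRTuple k S τ = length τ ≡ k × InVR r τ × All S τ

  VRTuple-∷ : ∀ {p ps k u τ} → All (Near p) ps → u ∈₂ p →
    VRTuple k (VertexOf ps) τ → VRTuple (suc k) (VertexOf (p ∷ ps)) (u ∷ τ)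
  VRTuple-∷ nearAll u∈p (len , inVR , vertices) =
    cong suc len , InVR-∷ (All.map (near-vertex nearAll u∈p) vertices) inVR , here u∈p ∷ All.map there vertices

  crossCycle-VRTuples : ∀ ps → AllPairs Near ps →
    All (VRTuple (length ps) (VertexOf ps) ∘ proj₂) (crossCycle ps)
  crossCycle-VRTuples [] [] = (refl , (λ _ _ ()) , []) ∷ []
  crossCycle-VRTuples ((v , w) ∷ ps) (nearAll ∷ nearPairs) =
    subst (All (VRTuple (suc (length ps)) (VertexOf ((v , w) ∷ ps)) ∘ proj₂)) (sym (crossCycle-∷ v w ps))
      (AllP.++⁺ (AllP.map⁺ (All.map (VRTuple-∷ nearAll (inj₁ refl)) tuples))
                (AllP.map⁺ (All.map (VRTuple-∷ nearAll (inj₂ refl)) (AllP.map⁺ tuples))))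
    where tuples = crossCycle-VRTuples ps nearPairs

  cone-IsVRChain : ∀ {k S} x c → (∀ {y} → S y → dH x y ≤ r) →
    All (VRTuple (suc k) S ∘ proj₂) c → IsVRChain r (suc k) (cone x c)
  cone-IsVRChain x c near tuples =
    AllP.map⁺ (All.map (λ (len , inVR , vertices) → cong suc len , InVR-∷ (All.map near vertices) inVR) tuples)

  crossCycle-isBoundaryVR : ∀ {k} ps x → length ps ≡ suc k → AllPairs Near ps →
    (∀ {y} → VertexOf ps y → dH x y ≤ r) → IsBoundaryVR r k (crossCycle ps)
  crossCycle-isBoundaryVR ps x len nearPairs near =
    cone x (crossCycle ps) ,
    cone-IsVRChain x (crossCycle ps) near tuples ,
    ∂-cone-cycle x (crossCycle ps) (crossCycle-isCycle ps)
    where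
    tuples = subst (λ l → All (VRTuple l (VertexOf ps) ∘ proj₂) (crossCycle ps)) len
                   (crossCycle-VRTuples ps nearPairs)

¬AdjComp⇒dH≤ : ∀ {n} r (x y : Q n) → ¬ AdjComp r x y → dH x y ≤ r
¬AdjComp⇒dH≤ r x y ¬adj with VecP.≡-dec BoolP._≟_ x y
... | yes refl = subst (_≤ r) (sym (dH-refl x)) z≤n
... | no x≢y = ℕP.≮⇒≥ (λ r<d → ¬adj (x≢y , r<d))

AdjComp? : ∀ {n} r (x y : Q n) → Dec (AdjComp r x y)
AdjComp? r x y = ¬? (VecP.≡-dec BoolP._≟_ x y) ×-dec (r ℕP.<? dH x y)

proposition2p4 : (n r m : ℕ) → 1 ≤ n → 1 ≤ m
    → (v w : Fin m → Q n)
    → (∀ i j → v i ≡ v j → i ≡ j)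
    → (∀ i j → w i ≡ w j → i ≡ j)
    → (∀ i j → v i ≢ w j)
    → (∀ i → r < dH (v i) (w i))
    → (∀ i j → i ≢ j → dH (v i) (v j) ≤ r)
    → (∀ i j → i ≢ j → dH (w i) (w j) ≤ r)
    → (∀ i j → i ≢ j → dH (v i) (w j) ≤ r)
    → ¬ IsBoundaryVR r (Data.Nat.pred m) (crossCycleOf v w)
    → TotalDominatingSet (AdjComp r) (PairSet v w)
proposition2p4 n r (suc k) _ _ v w _ _ _ _ dvv dww dvw nontrivial x
  with FinP.any? (λ i → AdjComp? r x (v i) ⊎-dec AdjComp? r x (w i))
... | yes (i , inj₁ adj) = v i , (i , inj₁ refl) , adj
... | yes (i , inj₂ adj) = w i , (i , inj₂ refl) , adj
... | no undominated = contradiction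
        (crossCycle-isBoundaryVR ps x (ListP.length-tabulate pair) (AllPairsP.tabulate⁺ near) close)
        nontrivial
  where
  open VietorisRips r
  pair : Fin (suc k) → Q n × Q n
  pair i = v i , w i
  ps = tabulate pair
  near : ∀ {i j} → i ≢ j → Near (pair i) (pair j)
  near {i} {j} i≢j (inj₁ refl) (inj₁ refl) = dvv i j i≢j
  near {i} {j} i≢j (inj₁ refl) (inj₂ refl) = dvw i j i≢j
  near {i} {j} i≢j (inj₂ refl) (inj₁ refl) = subst (_≤ r) (dH-sym (v j) (w i)) (dvw j i (i≢j ∘ sym))
  near {i} {j} i≢j (inj₂ refl) (inj₂ refl) = dww i j i≢j
  close : ∀ {y} → VertexOf ps y → dH x y ≤ r
  close y∈ps with AnyP.tabulate⁻ {f = pair} y∈ps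
  ... | i , inj₁ refl = ¬AdjComp⇒dH≤ r x (v i) (λ adj → undominated (i , inj₁ adj))
  ... | i , inj₂ refl = ¬AdjComp⇒dH≤ r x (w i) (λ adj → undominated (i , inj₂ adj))
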